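{- Consider many-sorted first-order terms with a counter sort $C$ (constructors $Z:C$, $S:C\to C$), a generator sort $Y$ with no function symbols, and a carrier sort $T$, with an active-site symbol $F:T\times Y\times C\to T$ and a frame constructor $G:Y\times T\to T$. Let $\rho(x,y,n)$ be a right-hand-side term of sort $T$ whose variables are among $x:T$, $y:Y$, $n:C$ (so that $F(x,y,S(n))\to\rho(x,y,n)$ is a step rule). If $\rho(x,y,n)$ contains both an occurrence of a subterm headed by $G$ and an occurrence of a subterm headed by $F$, then $\rho(x,y,n)$ contains at least two syntactically distinct occurrences (at distinct positions) of the generator variable $y$: one as the first argument of a $G$-headed subterm and one as the second (generator) argument of an $F$-headed subterm. -}

module Defs where

open import Data.Nat using (ℕ)
open import Data.List using (List; []; _∷_)
open import Data.Maybe using (Maybe; just; nothing)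

data Sort : Set where
  T Y C : Sort

data Tm : Sort → Set where
  varX : Tm T
  varY : Tm Y
  varN : Tm C
  Z    : Tm C
  S    : Tm C → Tm C
  F    : Tm T → Tm Y → Tm C → Tm T
  G    : Tm Y → Tm T → Tm T

data Head : Set where
  hx hy hn hZ hS hF hG : Head

head : ∀ {s} → Tm s → Head
head varX      = hx
head varY      = hy
head varN      = hn
head Z         = hZ
head (S _)     = hS
head (F _ _ _) = hF
head (G _ _)   = hG

-- Positions: lists of 1-based argument indices.
Pos : Set
Pos = List ℕ

headAt : ∀ {s} → Tm s → Pos → Maybe Head
headAt t []                     = just (head t)
headAt (S t)       (1 ∷ p)      = headAt t p
headAt (F t _ _)   (1 ∷ p)      = headAt t p
headAt (F _ u _)   (2 ∷ p)      = headAt u p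
headAt (F _ _ c)   (3 ∷ p)      = headAt c p
headAt (G u _)     (1 ∷ p)      = headAt u p
headAt (G _ t)     (2 ∷ p)      = headAt t p
headAt _           (_ ∷ _)      = nothing

{-# OPTIONS --safe #-}
-- The signature has no function symbol of sort Y, so the only term of sort Y
-- is the variable y.  Hence the first argument of every G-headed subterm and
-- the second argument of every F-headed subterm is y, and these two occurrences
-- sit at positions ending in 1 and in 2 respectively, so they are distinct.
module Submission where

open import Defs
open import Data.List using ([]; _∷_; _++_; _∷ʳ_)
open import Data.List.Properties using (∷ʳ-injectiveʳ)
open import Data.Maybe using (just)
open import Data.Nat using (ℕ)
open import Data.Product using (_×_; _,_; ∃-syntax; ∃₂)
open import Function using (_∘_)
open import Relation.Binary.PropositionalEquality using (_≡_; _≢_; refl)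

data SubtermAt : ∀ {s s′} → Tm s → Pos → Tm s′ → Set where
  here : ∀ {s} {t : Tm s} → SubtermAt t [] t
  S₁ : ∀ {s p c} {u : Tm s} → SubtermAt c p u → SubtermAt (S c) (1 ∷ p) u
  F₁ : ∀ {s p t y c} {u : Tm s} → SubtermAt t p u → SubtermAt (F t y c) (1 ∷ p) u
  F₂ : ∀ {s p t y c} {u : Tm s} → SubtermAt y p u → SubtermAt (F t y c) (2 ∷ p) u
  F₃ : ∀ {s p t y c} {u : Tm s} → SubtermAt c p u → SubtermAt (F t y c) (3 ∷ p) u
  G₁ : ∀ {s p y t} {u : Tm s} → SubtermAt y p u → SubtermAt (G y t) (1 ∷ p) u
  G₂ : ∀ {s p y t} {u : Tm s} → SubtermAt t p u → SubtermAt (G y t) (2 ∷ p) u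

SubtermAt-++ : ∀ {s s′ s″} {t : Tm s} {u : Tm s′} {v : Tm s″} {p q : Pos} →
               SubtermAt t p u → SubtermAt u q v → SubtermAt t (p ++ q) v
SubtermAt-++ here     u∣q = u∣q
SubtermAt-++ (S₁ t∣p) u∣q = S₁ (SubtermAt-++ t∣p u∣q)
SubtermAt-++ (F₁ t∣p) u∣q = F₁ (SubtermAt-++ t∣p u∣q)
SubtermAt-++ (F₂ t∣p) u∣q = F₂ (SubtermAt-++ t∣p u∣q)
SubtermAt-++ (F₃ t∣p) u∣q = F₃ (SubtermAt-++ t∣p u∣q)
SubtermAt-++ (G₁ t∣p) u∣q = G₁ (SubtermAt-++ t∣p u∣q)
SubtermAt-++ (G₂ t∣p) u∣q = G₂ (SubtermAt-++ t∣p u∣q)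

headAt-SubtermAt : ∀ {s s′} {t : Tm s} {u : Tm s′} {p : Pos} →
                   SubtermAt t p u → headAt t p ≡ just (head u)
headAt-SubtermAt here     = refl
headAt-SubtermAt (S₁ t∣p) = headAt-SubtermAt t∣p
headAt-SubtermAt (F₁ t∣p) = headAt-SubtermAt t∣p
headAt-SubtermAt (F₂ t∣p) = headAt-SubtermAt t∣p
headAt-SubtermAt (F₃ t∣p) = headAt-SubtermAt t∣p
headAt-SubtermAt (G₁ t∣p) = headAt-SubtermAt t∣p
headAt-SubtermAt (G₂ t∣p) = headAt-SubtermAt t∣p

headAt⇒SubtermAt : ∀ {s h} (t : Tm s) (p : Pos) → headAt t p ≡ just h →
                   ∃₂ λ s′ (u : Tm s′) → SubtermAt t p u × head u ≡ h
headAt⇒SubtermAt t         []                             refl = _ , t , here , refl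
headAt⇒SubtermAt (S c)     (1 ∷ p) eq with _ , u , c∣p , hu ← headAt⇒SubtermAt c p eq = _ , u , S₁ c∣p , hu
headAt⇒SubtermAt (F t y c) (1 ∷ p) eq with _ , u , t∣p , hu ← headAt⇒SubtermAt t p eq = _ , u , F₁ t∣p , hu
headAt⇒SubtermAt (F t y c) (2 ∷ p) eq with _ , u , y∣p , hu ← headAt⇒SubtermAt y p eq = _ , u , F₂ y∣p , hu
headAt⇒SubtermAt (F t y c) (3 ∷ p) eq with _ , u , c∣p , hu ← headAt⇒SubtermAt c p eq = _ , u , F₃ c∣p , hu
headAt⇒SubtermAt (G y t)   (1 ∷ p) eq with _ , u , y∣p , hu ← headAt⇒SubtermAt y p eq = _ , u , G₁ y∣p , hu
headAt⇒SubtermAt (G y t)   (2 ∷ p) eq with _ , u , t∣p , hu ← headAt⇒SubtermAt t p eq = _ , u , G₂ t∣p , hu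
headAt⇒SubtermAt varX      (_ ∷ _)                        ()
headAt⇒SubtermAt varY      (_ ∷ _)                        ()
headAt⇒SubtermAt varN      (_ ∷ _)                        ()
headAt⇒SubtermAt Z         (_ ∷ _)                        ()
headAt⇒SubtermAt (S _)     (0 ∷ _)                        ()
headAt⇒SubtermAt (S _)     (2 ∷ _)                        ()
headAt⇒SubtermAt (S _)     (ℕ.suc (ℕ.suc (ℕ.suc _)) ∷ _)  ()
headAt⇒SubtermAt (F _ _ _) (0 ∷ _)                        ()
headAt⇒SubtermAt (F _ _ _) (ℕ.suc (ℕ.suc (ℕ.suc (ℕ.suc _))) ∷ _) ()
headAt⇒SubtermAt (G _ _)   (0 ∷ _)                        ()
headAt⇒SubtermAt (G _ _)   (ℕ.suc (ℕ.suc (ℕ.suc _)) ∷ _)  ()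

headAt-G∷ʳ1≡y : ∀ {s} (t : Tm s) (p : Pos) → headAt t p ≡ just hG → headAt t (p ∷ʳ 1) ≡ just hy
headAt-G∷ʳ1≡y t p eq with _ , G varY _ , t∣p , refl ← headAt⇒SubtermAt t p eq =
  headAt-SubtermAt (SubtermAt-++ t∣p (G₁ here))

headAt-F∷ʳ2≡y : ∀ {s} (t : Tm s) (p : Pos) → headAt t p ≡ just hF → headAt t (p ∷ʳ 2) ≡ just hy
headAt-F∷ʳ2≡y t p eq with _ , F _ varY _ , t∣p , refl ← headAt⇒SubtermAt t p eq =
  headAt-SubtermAt (SubtermAt-++ t∣p (F₂ here))

theorem3p30 : (ρ : Tm T)
    → ∃[ p ] (headAt ρ p ≡ just hG)
    → ∃[ q ] (headAt ρ q ≡ just hF)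
    → ∃[ p ] ∃[ q ] (p ≢ q
        × headAt ρ p ≡ just hy × headAt ρ q ≡ just hy
        × ∃[ p′ ] (p ≡ p′ ++ (1 ∷ []) × headAt ρ p′ ≡ just hG)
        × ∃[ q′ ] (q ≡ q′ ++ (2 ∷ []) × headAt ρ q′ ≡ just hF))
theorem3p30 ρ (p , ρ∣p≡G) (q , ρ∣q≡F) =
  p ∷ʳ 1 , q ∷ʳ 2 ,
  (λ ()) ∘ ∷ʳ-injectiveʳ p q ,
  headAt-G∷ʳ1≡y ρ p ρ∣p≡G , headAt-F∷ʳ2≡y ρ q ρ∣q≡F ,
  p , (refl , ρ∣p≡G) , q , refl , ρ∣q≡F
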